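{- Let $h\geq 1$. (1) Let $G=(V^{(1)},V^{(2)};E)$ be a bipartite graph with $|V^{(1)}|=|V^{(2)}|=M$, where $h$ divides $M$, and such that each vertex is adjacent to at least $\left(1-\frac{1}{2h^2}\right)M$ vertices in the other part. Then $G$ has a $K_{h,h}$-factor. (2) Let $G=(V^{(1)},V^{(2)},V^{(3)};E)$ be a tripartite graph with $|V^{(1)}|=|V^{(2)}|=|V^{(3)}|=M$, where $h$ divides $M$, and such that each vertex is adjacent to at least $\left(1-\frac{1}{4h^2}\right)M$ vertices in each of the other two parts. Suppose the bipartite graph induced by $(V^{(2)},V^{(3)})$ has a $K_{h,h}$-factor. Then this factor can be extended to a $K_{h,h,h}$-factor of $G$, i.e. there is a $K_{h,h,h}$-factor of $G$ in which each copy of $K_{h,h,h}$ contains one of the given copies of $K_{h,h}$ together with $h$ vertices of $V^{(1)}$.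
   Context: A $K_{h,h}$-factor (resp. $K_{h,h,h}$-factor) is a collection of vertex-disjoint copies of $K_{h,h}$ (resp. $K_{h,h,h}$) covering all vertices of the graph. -}

module Defs where

open import Data.Nat using (ℕ; _*_; _∸_; _≥_)
open import Data.Fin using (Fin)
open import Data.Fin.Subset using (Subset; ∣_∣)
open import Data.Vec using (tabulate)
open import Data.Bool using (Bool; true)
open import Data.Product using (Σ; _×_; _,_; ∃)
open import Relation.Binary.PropositionalEquality using (_≡_)

-- A bipartite "edge relation" between two parts of size M (part sizes are Fin M).
-- E x y = true  iff  x ∈ V⁽¹⁾ and y ∈ V⁽²⁾ are adjacent.
BipEdges : ℕ → Set
BipEdges M = Fin M → Fin M → Bool

nbhdˡ : ∀ {M} → BipEdges M → Fin M → Subset M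
nbhdˡ E x = tabulate (λ y → E x y)

nbhdʳ : ∀ {M} → BipEdges M → Fin M → Subset M
nbhdʳ E y = tabulate (λ x → E x y)

degˡ : ∀ {M} → BipEdges M → Fin M → ℕ
degˡ E x = ∣ nbhdˡ E x ∣

degʳ : ∀ {M} → BipEdges M → Fin M → ℕ
degʳ E y = ∣ nbhdʳ E y ∣

-- "deg ≥ (1 - 1/c) M", i.e. c * deg ≥ (c - 1) * M  (c > 0).
AtLeastFrac : (c M d : ℕ) → Set
AtLeastFrac c M d = c * d ≥ (c ∸ 1) * M

IsPartition : ∀ {M} (t h : ℕ) → (Fin t → Fin h → Fin M) → Set
IsPartition {M} t h f =
  (∀ i a j b → f i a ≡ f j b → (i ≡ j) × (a ≡ b)) ×
  (∀ (x : Fin M) → ∃ λ i → ∃ λ a → f i a ≡ x)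

-- A K_{h,h}-factor of the bipartite graph (V⁽¹⁾,V⁽²⁾;E): t vertex-disjoint copies of K_{h,h},
-- copy i having side f₁ i ⊆ V⁽¹⁾ and side f₂ i ⊆ V⁽²⁾, covering all vertices.
record KhhFactor {M} (h : ℕ) (E : BipEdges M) : Set where
  field
    t    : ℕ
    f₁   : Fin t → Fin h → Fin M
    f₂   : Fin t → Fin h → Fin M
    part₁ : IsPartition t h f₁
    part₂ : IsPartition t h f₂
    complete : ∀ i a b → E (f₁ i a) (f₂ i b) ≡ true

IsKhhhFactor : ∀ {M} (h : ℕ) (E₁₂ E₁₃ E₂₃ : BipEdges M) (t : ℕ)
  (g₁ g₂ g₃ : Fin t → Fin h → Fin M) → Set
IsKhhhFactor h E₁₂ E₁₃ E₂₃ t g₁ g₂ g₃ =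
  IsPartition t h g₁ × IsPartition t h g₂ × IsPartition t h g₃ ×
  (∀ i a b → E₁₂ (g₁ i a) (g₂ i b) ≡ true) ×
  (∀ i a b → E₁₃ (g₁ i a) (g₃ i b) ≡ true) ×
  (∀ i a b → E₂₃ (g₂ i a) (g₃ i b) ≡ true)

-- Both parts rest on one matching lemma: if every vertex of a bipartite graph on n + n
-- vertices has at most n/2 non-neighbours, a permutation σ with the fewest non-edges x – σ x
-- is a perfect matching, because a non-edge u – σ u can always be removed by exchanging
-- partners with some x for which u – σ x and x – σ u are both edges.
--
-- Partition one side into blocks (in (1) arbitrary h-sets of V⁽¹⁾, in (2) the copies of K_{h,h}
-- in the given factor) and call a vertex of the other side compatible with a block if it is
-- adjacent to all of it. The degree conditions give that each block is incompatible
-- with at most M/2 vertices and each vertex with at most M/(2h) blocks. Blowing every block up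
-- into h copies, the compatibility graph thus satisfies the matching lemma, and the matching
-- assigns to each block h compatible vertices.

module Submission where

open import Defs

open import Data.Bool using (Bool; true; false; _∧_) renaming (_≟_ to _≟ᵇ_)
open import Data.Bool.Properties using (¬-not)
open import Data.Empty using (⊥-elim)
open import Data.Fin using (Fin; zero; suc; combine; remQuot; _↑ˡ_; _↑ʳ_; _≟_)
open import Data.Fin.Permutation
  using (Permutation; Permutation′; _⟨$⟩ʳ_; _⟨$⟩ˡ_; _∘ₚ_; transpose; permutation; inverseˡ; inverseʳ)
  renaming (id to idₚ)
open import Data.Fin.Subset using (∣_∣)
open import Data.Fin.Properties
  using (any?; combine-injective; combine-surjective; remQuot-combine; combine-remQuot)
open import Data.Nat using (ℕ; zero; suc; _+_; _*_; _≤_; _<_; z≤n; s≤s; NonZero; >-nonZero)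
open import Data.Nat.Properties hiding (_≟_)
open import Data.Nat.Divisibility using (_∣_; divides)
open import Data.Nat.Induction using (<-wellFounded)
open import Data.Nat.Solver using (module +-*-Solver)
open import Data.Product using (Σ; Σ-syntax; ∃; _×_; _,_; proj₁; proj₂; uncurry)
open import Data.Vec using (tabulate)
open import Function using (_∘_; flip)
open import Induction.WellFounded using (Acc; acc)
open import Relation.Binary.PropositionalEquality
open import Relation.Nullary using (yes; no)
open import Relation.Nullary.Decidable using (dec-true)

open import Algebra.Properties.Semiring.Sum +-*-semiring
  using (sum; sum-syntax; ∑-distrib-+; ∑-comm; ∑-permute; *-distribˡ-sum; sum-cong-≗)
open +-*-Solver using (solve; _:*_; con; _:=_)

∑-const : ∀ n c → ∑[ i < n ] c ≡ n * c
∑-const zero    c = refl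
∑-const (suc n) c = cong (c +_) (∑-const n c)

∑-mono-≤ : ∀ {n} {f g : Fin n → ℕ} → (∀ i → f i ≤ g i) → sum f ≤ sum g
∑-mono-≤ {zero}  f≤g = z≤n
∑-mono-≤ {suc n} f≤g = +-mono-≤ (f≤g zero) (∑-mono-≤ (f≤g ∘ suc))

∑-mono-< : ∀ {n} {f g : Fin n → ℕ} → (∀ i → f i ≤ g i) → ∀ u → f u < g u → sum f < sum g
∑-mono-< f≤g zero    fu<gu = +-mono-<-≤ fu<gu (∑-mono-≤ (f≤g ∘ suc))
∑-mono-< f≤g (suc u) fu<gu = +-mono-≤-< (f≤g zero) (∑-mono-< (f≤g ∘ suc) u fu<gu)

∑-bounded : ∀ {n B} {f : Fin n → ℕ} → (∀ i → f i ≤ B) → sum f ≤ n * B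
∑-bounded {n} {B} f≤B = subst (_ ≤_) (∑-const n B) (∑-mono-≤ f≤B)

∑-↑ : ∀ m n (f : Fin (m + n) → ℕ) →
  sum f ≡ ∑[ i < m ] f (i ↑ˡ n) + ∑[ j < n ] f (m ↑ʳ j)
∑-↑ zero    n f = refl
∑-↑ (suc m) n f = trans (cong (f zero +_) (∑-↑ m n (f ∘ suc))) (sym (+-assoc (f zero) _ _))

∑-combine : ∀ m n (f : Fin (m * n) → ℕ) →
  sum f ≡ ∑[ i < m ] ∑[ j < n ] f (combine i j)
∑-combine zero    n f = refl
∑-combine (suc m) n f =
  trans (∑-↑ n (m * n) f) (cong (sum (λ j → f (j ↑ˡ (m * n))) +_) (∑-combine m n (f ∘ (n ↑ʳ_))))

miss : Bool → ℕ
miss true  = 0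
miss false = 1

#false : ∀ {n} → (Fin n → Bool) → ℕ
#false {n} f = ∑[ x < n ] miss (f x)

miss-≢true : ∀ {b} → b ≢ true → miss b ≡ 1
miss-≢true {true}  b≢true = ⊥-elim (b≢true refl)
miss-≢true {false} _      = refl

miss-∧ : ∀ a b → miss (a ∧ b) ≤ miss a + miss b
miss-∧ true  b = ≤-refl
miss-∧ false b = s≤s z≤n

∧-true⁻ : ∀ {a b} → a ∧ b ≡ true → a ≡ true × b ≡ true
∧-true⁻ {true} {true} _ = refl , refl

#false-∧ : ∀ {n} (f g : Fin n → Bool) → #false (λ x → f x ∧ g x) ≤ #false f + #false g
#false-∧ f g = ≤-trans (∑-mono-≤ (λ x → miss-∧ (f x) (g x)))
                       (≤-reflexive (∑-distrib-+ (miss ∘ f) (miss ∘ g)))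

∣tabulate∣+#false : ∀ {n} (f : Fin n → Bool) → ∣ tabulate f ∣ + #false f ≡ n
∣tabulate∣+#false {zero}  f = refl
∣tabulate∣+#false {suc n} f with f zero
... | true  = cong suc (∣tabulate∣+#false (f ∘ suc))
... | false = trans (+-suc _ _) (cong suc (∣tabulate∣+#false (f ∘ suc)))

Sparse : ∀ {m n} → ℕ → ℕ → (Fin m → Fin n → Bool) → Set
Sparse c N E = ∀ x → c * #false (E x) ≤ N

#false-bound : ∀ c {n} (f : Fin n → Bool) → AtLeastFrac c n ∣ tabulate f ∣ → c * #false f ≤ n
#false-bound zero    f _     = z≤n
#false-bound (suc c) {n} f dense = +-cancelˡ-≤ (c * n) _ _ (begin
  c * n + suc c * e      ≤⟨ +-monoˡ-≤ (suc c * e) dense ⟩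
  suc c * d + suc c * e  ≡⟨ *-distribˡ-+ (suc c) d e ⟨
  suc c * (d + e)        ≡⟨ cong (suc c *_) (∣tabulate∣+#false f) ⟩
  n + c * n              ≡⟨ +-comm n (c * n) ⟩
  c * n + n              ∎)
  where
  open ≤-Reasoning
  d e : ℕ
  d = ∣ tabulate f ∣
  e = #false f

dense⇒sparse : ∀ c {n} (E : BipEdges n) →
  (∀ x → AtLeastFrac c n (degˡ E x)) → Sparse c n E
dense⇒sparse c E dense x = #false-bound c (E x) (dense x)

⋀ : ∀ {n} → (Fin n → Bool) → Bool
⋀ {zero}  f = true
⋀ {suc n} f = f zero ∧ ⋀ (f ∘ suc)

⋀-true⁻ : ∀ {n} (f : Fin n → Bool) → ⋀ f ≡ true → ∀ i → f i ≡ true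
⋀-true⁻ f all zero    = proj₁ (∧-true⁻ all)
⋀-true⁻ f all (suc i) = ⋀-true⁻ (f ∘ suc) (proj₂ (∧-true⁻ {f zero} all)) i

miss-⋀ : ∀ {n} (f : Fin n → Bool) → miss (⋀ f) ≤ #false f
miss-⋀ {zero}  f = z≤n
miss-⋀ {suc n} f = ≤-trans (miss-∧ (f zero) (⋀ (f ∘ suc))) (+-monoʳ-≤ (miss (f zero)) (miss-⋀ (f ∘ suc)))

transpose-appliedˡ : ∀ {n} (i j : Fin n) → transpose i j ⟨$⟩ʳ i ≡ j
transpose-appliedˡ i j rewrite dec-true (i ≟ i) refl = refl

+-≤-halves : ∀ {a b n} → 2 * a ≤ n → 2 * b ≤ n → a + b ≤ n
+-≤-halves {a} {b} {n} 2a≤n 2b≤n = *-cancelˡ-≤ 2 (begin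
  2 * (a + b)      ≡⟨ *-distribˡ-+ 2 a b ⟩
  2 * a + 2 * b    ≤⟨ +-mono-≤ 2a≤n 2b≤n ⟩
  n + n            ≡⟨ cong (n +_) (+-identityʳ n) ⟨
  2 * n            ∎)
  where open ≤-Reasoning

module PerfectMatching {n} (R : BipEdges n)
  (sparseRows : Sparse 2 n R) (sparseCols : Sparse 2 n (flip R)) where

  defects : Permutation′ n → ℕ
  defects π = #false (λ x → R x (π ⟨$⟩ʳ x))

  -- Otherwise every x is a non-neighbour of u (via π x) or of π u, and u is both: more than
  -- n non-neighbours in total, against the sparseness of row u and column π u.
  exchangePartner : ∀ π u → R u (π ⟨$⟩ʳ u) ≡ false →
    ∃ λ x → R u (π ⟨$⟩ʳ x) ≡ true × R x (π ⟨$⟩ʳ u) ≡ true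
  exchangePartner π u Ruu with any? (λ x → (R u (π ⟨$⟩ʳ x) ∧ R x (π ⟨$⟩ʳ u)) ≟ᵇ true)
  ... | yes (x , both) = x , ∧-true⁻ both
  ... | no  none       = ⊥-elim (<⇒≱ crowded sparse)
    where
    v : Fin n
    v = π ⟨$⟩ʳ u

    misses : Fin n → ℕ
    misses x = miss (R u (π ⟨$⟩ʳ x)) + miss (R x v)

    missesEveryone : ∀ x → 1 ≤ misses x
    missesEveryone x = ≤-trans (≤-reflexive (sym (miss-≢true (none ∘ (x ,_)))))
                               (miss-∧ (R u (π ⟨$⟩ʳ x)) (R x v))

    missesTwice : 1 < misses u
    missesTwice rewrite Ruu = ≤-refl

    crowded : n < sum misses
    crowded = subst (_< sum misses) (trans (∑-const n 1) (*-identityʳ n))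
                    (∑-mono-< missesEveryone u missesTwice)

    sparse : sum misses ≤ n
    sparse = subst (_≤ n) (trans (cong (_+ #false (λ x → R x v)) (∑-permute (miss ∘ R u) π))
                                 (sym (∑-distrib-+ (miss ∘ R u ∘ (π ⟨$⟩ʳ_)) (λ x → miss (R x v)))))
                   (+-≤-halves {#false (R u)} (sparseRows u) (sparseCols v))

  exchange-decreases : ∀ π u x → R u (π ⟨$⟩ʳ u) ≡ false →
    R u (π ⟨$⟩ʳ x) ≡ true → R x (π ⟨$⟩ʳ u) ≡ true →
    defects (transpose u x ∘ₚ π) < defects π
  exchange-decreases π u x Ruu Rux Rxu = ∑-mono-< noWorse u better
    where
    π′ : Permutation′ n
    π′ = transpose u x ∘ₚ π

    -- Splitting on z ≟ u and then z ≟ x follows the case analysis inside transpose.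
    noWorse : ∀ z → miss (R z (π′ ⟨$⟩ʳ z)) ≤ miss (R z (π ⟨$⟩ʳ z))
    noWorse z with z ≟ u
    ... | yes refl rewrite Rux = z≤n
    ... | no  _ with z ≟ x
    ...   | yes refl rewrite Rxu = z≤n
    ...   | no  _ = ≤-refl

    better : miss (R u (π′ ⟨$⟩ʳ u)) < miss (R u (π ⟨$⟩ʳ u))
    better rewrite transpose-appliedˡ u x | Rux | Ruu = ≤-refl

  perfectMatching : Σ[ σ ∈ Permutation′ n ] (∀ x → R x (σ ⟨$⟩ʳ x) ≡ true)
  perfectMatching = descend idₚ (<-wellFounded (defects idₚ))
    where
    descend : ∀ π → Acc _<_ (defects π) → Σ[ σ ∈ Permutation′ n ] (∀ x → R x (σ ⟨$⟩ʳ x) ≡ true)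
    descend π (acc smaller) with any? (λ u → R u (π ⟨$⟩ʳ u) ≟ᵇ false)
    ... | no  noDefect  = π , λ x → ¬-not (noDefect ∘ (x ,_))
    ... | yes (u , Ruu) with exchangePartner π u Ruu
    ...   | x , Rux , Rxu =
      descend (transpose u x ∘ₚ π) (smaller (exchange-decreases π u x Ruu Rux Rxu))

combine-isPartition : ∀ t h → IsPartition t h (combine {t} {h})
combine-isPartition t h =
  combine-injective , λ x → let i , a , eq = combine-surjective {t} {h} x in i , a , eq

isPartition-∘ : ∀ {t h M} {p : Fin t → Fin h → Fin M} (σ : Permutation′ M) →
  IsPartition t h p → IsPartition t h (λ i a → σ ⟨$⟩ʳ p i a)
isPartition-∘ {p = p} σ (injective , surjective) =
  (λ i a j b eq → injective i a j b (trans (sym (inverseˡ σ)) (trans (cong (σ ⟨$⟩ˡ_) eq) (inverseˡ σ)))) ,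
  (λ y → let i , a , eq = surjective (σ ⟨$⟩ˡ y) in i , a , trans (cong (σ ⟨$⟩ʳ_) eq) (inverseʳ σ))

record CompatibleBlocks {t M} (h : ℕ) (Compatible : Fin t → Fin M → Bool) : Set where
  field
    blocks      : Fin t → Fin h → Fin M
    isPartition : IsPartition t h blocks
    compatible  : ∀ i a → Compatible i (blocks i a) ≡ true

module Blocks {t h M} {p : Fin t → Fin h → Fin M} (partition : IsPartition t h p) where

  blockOf : Fin M → Fin t
  blockOf x = proj₁ (proj₂ partition x)

  slotOf : Fin M → Fin h
  slotOf x = proj₁ (proj₂ (proj₂ partition x))

  p-blockOf-slotOf : ∀ x → p (blockOf x) (slotOf x) ≡ x
  p-blockOf-slotOf x = proj₂ (proj₂ (proj₂ partition x))

  blockOf-p : ∀ i a → blockOf (p i a) ≡ i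
  blockOf-p i a = proj₁ (proj₁ partition _ _ i a (p-blockOf-slotOf (p i a)))

  slotOf-p : ∀ i a → slotOf (p i a) ≡ a
  slotOf-p i a = proj₂ (proj₁ partition _ _ i a (p-blockOf-slotOf (p i a)))

  enumeration : Permutation (t * h) M
  enumeration = permutation (uncurry p ∘ remQuot h) (λ x → combine (blockOf x) (slotOf x))
    (λ x → trans (cong (uncurry p) (remQuot-combine (blockOf x) (slotOf x))) (p-blockOf-slotOf x))
    (λ k → let i , a = remQuot {t} h k in
      trans (cong₂ combine (blockOf-p i a) (slotOf-p i a)) (combine-remQuot {t} h k))

  ∑-blocks : (g : Fin M → ℕ) → sum g ≡ ∑[ i < t ] ∑[ a < h ] g (p i a)
  ∑-blocks g = begin
    sum g                                          ≡⟨ ∑-permute g enumeration ⟩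
    ∑[ k < t * h ] g (enumeration ⟨$⟩ʳ k)          ≡⟨ ∑-combine t h _ ⟩
    ∑[ i < t ] ∑[ a < h ] g (uncurry p (remQuot h (combine i a)))
      ≡⟨ sum-cong-≗ (λ i → sum-cong-≗ (λ a → cong (g ∘ uncurry p) (remQuot-combine i a))) ⟩
    ∑[ i < t ] ∑[ a < h ] g (p i a)                ∎
    where open ≡-Reasoning

  matchBlocks : (Compatible : Fin t → Fin M → Bool) →
    Sparse 2 M Compatible → Sparse (2 * h) M (flip Compatible) → CompatibleBlocks h Compatible
  matchBlocks Compatible sparseBlocks sparseVertices = record
    { blocks      = q
    ; isPartition = isPartition-∘ σ partition
    ; compatible  = λ i a → subst (λ j → Compatible j (q i a) ≡ true) (blockOf-p i a) (σ-matches (p i a))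
    }
    where
    R : Fin M → Fin M → Bool
    R x y = Compatible (blockOf x) y

    #false-blownUp : ∀ y → #false (λ x → R x y) ≡ h * #false (λ i → Compatible i y)
    #false-blownUp y = begin
      #false (λ x → R x y)                                  ≡⟨ ∑-blocks (λ x → miss (R x y)) ⟩
      ∑[ i < t ] ∑[ a < h ] miss (R (p i a) y)
        ≡⟨ sum-cong-≗ (λ i → sum-cong-≗ (λ a → cong (λ j → miss (Compatible j y)) (blockOf-p i a))) ⟩
      ∑[ i < t ] ∑[ a < h ] miss (Compatible i y)           ≡⟨ sum-cong-≗ (λ i → ∑-const h (miss (Compatible i y))) ⟩
      ∑[ i < t ] (h * miss (Compatible i y))                ≡⟨ *-distribˡ-sum h (λ i → miss (Compatible i y)) ⟨
      h * #false (λ i → Compatible i y)                     ∎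
      where open ≡-Reasoning

    sparseCols : Sparse 2 M (flip R)
    sparseCols y = subst (_≤ M) (trans (*-assoc 2 h _) (cong (2 *_) (sym (#false-blownUp y))))
                         (sparseVertices y)

    open PerfectMatching R (sparseBlocks ∘ blockOf) sparseCols using (perfectMatching)

    σ : Permutation′ M
    σ = proj₁ perfectMatching

    σ-matches : ∀ x → R x (σ ⟨$⟩ʳ x) ≡ true
    σ-matches = proj₂ perfectMatching

    q : Fin t → Fin h → Fin M
    q i a = σ ⟨$⟩ʳ p i a

  adjacentToBlock : ∀ {N} → (Fin M → Fin N → Bool) → Fin t → Fin N → Bool
  adjacentToBlock E i y = ⋀ (λ a → E (p i a) y)

  module _ (c : ℕ) {N} (E : Fin M → Fin N → Bool) where

    #false-adjacentToBlock : Sparse c N E → Sparse c (h * N) (adjacentToBlock E)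
    #false-adjacentToBlock sparse i = begin
      c * #false (adjacentToBlock E i)        ≤⟨ *-monoʳ-≤ c (∑-mono-≤ (λ y → miss-⋀ (λ a → E (p i a) y))) ⟩
      c * (∑[ y < N ] ∑[ a < h ] miss (E (p i a) y))  ≡⟨ cong (c *_) (∑-comm (λ y a → miss (E (p i a) y))) ⟩
      c * (∑[ a < h ] #false (E (p i a)))     ≡⟨ *-distribˡ-sum c (λ a → #false (E (p i a))) ⟩
      ∑[ a < h ] (c * #false (E (p i a)))     ≤⟨ ∑-bounded (λ a → sparse (p i a)) ⟩
      h * N                                   ∎
      where open ≤-Reasoning

    #false-blocksAdjacentTo : Sparse c M (flip E) → Sparse c M (flip (adjacentToBlock E))
    #false-blocksAdjacentTo sparse y = begin
      c * #false (λ i → adjacentToBlock E i y)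
        ≤⟨ *-monoʳ-≤ c (∑-mono-≤ (λ i → miss-⋀ (λ a → E (p i a) y))) ⟩
      c * (∑[ i < t ] ∑[ a < h ] miss (E (p i a) y))  ≡⟨ cong (c *_) (∑-blocks (λ x → miss (E x y))) ⟨
      c * #false (λ x → E x y)                        ≤⟨ sparse y ⟩
      M                                               ∎
      where open ≤-Reasoning

2h²X≤M⇒2hX≤M : ∀ h {X M} .{{_ : NonZero h}} → 2 * h * h * X ≤ M → 2 * h * X ≤ M
2h²X≤M⇒2hX≤M h {X} le = ≤-trans (*-monoˡ-≤ X (m≤m*n (2 * h) h)) le

2h²X≤hM⇒2X≤M : ∀ h {X M} .{{_ : NonZero h}} → 2 * h * h * X ≤ h * M → 2 * X ≤ M
2h²X≤hM⇒2X≤M h {X} {M} le = ≤-trans (*-monoˡ-≤ X (m≤m*n 2 h)) (*-cancelˡ-≤ h (begin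
  h * (2 * h * X)   ≡⟨ solve 2 (λ h X → h :* (con 2 :* h :* X) := con 2 :* h :* h :* X) refl h X ⟩
  2 * h * h * X     ≤⟨ le ⟩
  h * M             ∎))
  where open ≤-Reasoning

4h²-halves : ∀ h {X A B N} → 4 * h * h * A ≤ N → 4 * h * h * B ≤ N → X ≤ A + B → 2 * h * h * X ≤ N
4h²-halves h {X} {A} {B} {N} le₁ le₂ X≤A+B = *-cancelˡ-≤ 2 (begin
  2 * (2 * h * h * X)        ≡⟨ solve 2 (λ h X → con 2 :* (con 2 :* h :* h :* X) := con 4 :* h :* h :* X) refl h X ⟩
  4 * h * h * X              ≤⟨ *-monoʳ-≤ (4 * h * h) X≤A+B ⟩
  4 * h * h * (A + B)        ≡⟨ *-distribˡ-+ (4 * h * h) A B ⟩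
  4 * h * h * A + 4 * h * h * B ≤⟨ +-mono-≤ le₁ le₂ ⟩
  N + N                      ≡⟨ cong (N +_) (+-identityʳ N) ⟨
  2 * N                      ∎)
  where open ≤-Reasoning

khhFactor : ∀ h .{{_ : NonZero h}} (M : ℕ) → h ∣ M → (E : BipEdges M) →
  (∀ x → AtLeastFrac (2 * h * h) M (degˡ E x)) →
  (∀ y → AtLeastFrac (2 * h * h) M (degʳ E y)) →
  KhhFactor h E
khhFactor h _ (divides t refl) E denseˡ denseʳ = record
  { t        = t
  ; f₁       = combine
  ; f₂       = blocks
  ; part₁    = combine-isPartition t h
  ; part₂    = isPartition
  ; complete = λ i a b → ⋀-true⁻ _ (compatible i b) a
  }
  where
  open Blocks (combine-isPartition t h)

  c : ℕ
  c = 2 * h * h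

  match : CompatibleBlocks h (adjacentToBlock E)
  match = matchBlocks (adjacentToBlock E)
    (2h²X≤hM⇒2X≤M h ∘ #false-adjacentToBlock c E (dense⇒sparse c E denseˡ))
    (2h²X≤M⇒2hX≤M h ∘ #false-blocksAdjacentTo c E (dense⇒sparse c (flip E) denseʳ))

  open CompatibleBlocks match

khhhFactor-extending : ∀ h .{{_ : NonZero h}} {M : ℕ} (E₁₂ E₁₃ E₂₃ : BipEdges M) →
  (∀ x → AtLeastFrac (4 * h * h) M (degˡ E₁₂ x)) →
  (∀ x → AtLeastFrac (4 * h * h) M (degˡ E₁₃ x)) →
  (∀ y → AtLeastFrac (4 * h * h) M (degʳ E₁₂ y)) →
  (∀ z → AtLeastFrac (4 * h * h) M (degʳ E₁₃ z)) →
  (F : KhhFactor h E₂₃) →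
  Σ (Fin (KhhFactor.t F) → Fin h → Fin M) λ g₁ →
    IsKhhhFactor h E₁₂ E₁₃ E₂₃ (KhhFactor.t F) g₁ (KhhFactor.f₁ F) (KhhFactor.f₂ F)
khhhFactor-extending h {M} E₁₂ E₁₃ E₂₃ dense₁₂ˡ dense₁₃ˡ dense₁₂ʳ dense₁₃ʳ F =
  blocks , isPartition , F.part₁ , F.part₂ ,
  (λ i a → ⋀-true⁻ _ (proj₁ (∧-true⁻ (compatible i a)))) ,
  (λ i a → ⋀-true⁻ _ (proj₂ (∧-true⁻ (compatible i a)))) ,
  F.complete
  where
  module F  = KhhFactor F
  module B₂ = Blocks F.part₁
  module B₃ = Blocks F.part₂

  c : ℕ
  c = 4 * h * h

  adjacent₁₂ adjacent₁₃ : Fin F.t → Fin M → Bool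
  adjacent₁₂ = B₂.adjacentToBlock (flip E₁₂)
  adjacent₁₃ = B₃.adjacentToBlock (flip E₁₃)

  Compatible : Fin F.t → Fin M → Bool
  Compatible i x = adjacent₁₂ i x ∧ adjacent₁₃ i x

  match : CompatibleBlocks h Compatible
  match = B₂.matchBlocks Compatible
    (λ i → 2h²X≤hM⇒2X≤M h (4h²-halves h
      (B₂.#false-adjacentToBlock c (flip E₁₂) (dense⇒sparse c (flip E₁₂) dense₁₂ʳ) i)
      (B₃.#false-adjacentToBlock c (flip E₁₃) (dense⇒sparse c (flip E₁₃) dense₁₃ʳ) i)
      (#false-∧ (adjacent₁₂ i) (adjacent₁₃ i))))
    (λ x → 2h²X≤M⇒2hX≤M h (4h²-halves h
      (B₂.#false-blocksAdjacentTo c (flip E₁₂) (dense⇒sparse c E₁₂ dense₁₂ˡ) x)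
      (B₃.#false-blocksAdjacentTo c (flip E₁₃) (dense⇒sparse c E₁₃ dense₁₃ˡ) x)
      (#false-∧ (flip adjacent₁₂ x) (flip adjacent₁₃ x))))

  open CompatibleBlocks match

mainTheorem4 : (h : ℕ) → 1 ≤ h →
    ((M : ℕ) → h ∣ M → (E : BipEdges M) →
      (∀ x → AtLeastFrac (2 * h * h) M (degˡ E x)) →
      (∀ y → AtLeastFrac (2 * h * h) M (degʳ E y)) →
      KhhFactor h E)
    ×
    ((M : ℕ) → h ∣ M → (E₁₂ E₁₃ E₂₃ : BipEdges M) →
      (∀ x → AtLeastFrac (4 * h * h) M (degˡ E₁₂ x)) →
      (∀ x → AtLeastFrac (4 * h * h) M (degˡ E₁₃ x)) →
      (∀ y → AtLeastFrac (4 * h * h) M (degʳ E₁₂ y)) →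
      (∀ y → AtLeastFrac (4 * h * h) M (degˡ E₂₃ y)) →
      (∀ z → AtLeastFrac (4 * h * h) M (degʳ E₁₃ z)) →
      (∀ z → AtLeastFrac (4 * h * h) M (degʳ E₂₃ z)) →
      (F : KhhFactor h E₂₃) →
      Σ (Fin (KhhFactor.t F) → Fin h → Fin M) λ g₁ →
        IsKhhhFactor h E₁₂ E₁₃ E₂₃ (KhhFactor.t F) g₁ (KhhFactor.f₁ F) (KhhFactor.f₂ F))
mainTheorem4 h 1≤h =
  khhFactor h ,
  λ _ _ E₁₂ E₁₃ E₂₃ dense₁₂ˡ dense₁₃ˡ dense₁₂ʳ _ dense₁₃ʳ _ →
    khhhFactor-extending h E₁₂ E₁₃ E₂₃ dense₁₂ˡ dense₁₃ˡ dense₁₂ʳ dense₁₃ʳ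
  where
  instance
    h≢0 : NonZero h
    h≢0 = >-nonZero 1≤h
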